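{- Let $B$ be an integral base-polyhedron in $\mathbb{R}^S$, $|S|=n$. An element $m$ of $B\cap\mathbb{Z}^S$ is decreasingly minimal in $B\cap\mathbb{Z}^S$ if and only if $m$ is a simultaneous $k$-largest-sum minimizer, i.e. for every $k=1,\dots,n$ the sum of the $k$ largest components of $m$ is minimum among all elements of $B\cap\mathbb{Z}^S$.
   Context: $S$ is a finite non-empty set. An integral base-polyhedron is $B=B'(p)=\{x\in\mathbb{R}^S:\widetilde x(S)=p(S),\ \widetilde x(Z)\ge p(Z)\ \forall Z\subset S\}$, where $\widetilde x(Z)=\sum_{s\in Z}x(s)$ and $p$ is a set-function on $S$ with values in $\mathbb{Z}\cup\{ -\infty\}$, $p(\emptyset)=0$, $p(S)$ finite, supermodular ($p(X)+p(Y)\le p(X\cap Y)+p(X\cup Y)$ whenever $p(X),p(Y)$ finite). For $x\in\mathbb{R}^S$, $x{\downarrow}$ denotes the components of $x$ in decreasing order; $x\le_{\rm dec}y$ if $x{\downarrow}=y{\downarrow}$ or $x{\downarrow}(j)<y{\downarrow}(j)$ at the first index $j$ where they differ. $m\in B\cap\mathbb{Z}^S$ is decreasingly minimal if $m\le_{\rm dec}y$ for every $y\in B\cap\mathbb{Z}^S$. -}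

module Defs where

open import Data.Nat using (ℕ; zero; suc; _≤_)
open import Data.Integer as ℤ using (ℤ; 0ℤ; _+_; _≤?_)
open import Data.Fin using (Fin)
open import Data.Fin.Subset using (Subset; Side; inside; outside; _∩_; _∪_; ⊥; ⊤)
open import Data.Vec using (lookup)
open import Data.List using (List; []; _∷_; map; foldr; take; length)
open import Data.List.Base using (allFin)
open import Data.Maybe using (Maybe; just; nothing)
open import Data.Product using (Σ; ∃; _×_; _,_)
open import Data.Sum using (_⊎_)
open import Data.Unit using () renaming (⊤ to Unit)
open import Data.Empty using () renaming (⊥ to Empty)
open import Relation.Nullary using (yes; no)
open import Relation.Binary.PropositionalEquality using (_≡_)

-- Extended integers ℤ ∪ {-∞}: nothing represents -∞.
ℤ∞ : Set
ℤ∞ = Maybe ℤ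

Vecℤ : ℕ → Set
Vecℤ n = Fin n → ℤ

sumℤ : List ℤ → ℤ
sumℤ = foldr _+_ 0ℤ

weight : Side → ℤ → ℤ
weight inside  a = a
weight outside a = 0ℤ

x̃ : ∀ {n} → Vecℤ n → Subset n → ℤ
x̃ {n} x Z = sumℤ (map (λ i → weight (lookup Z i) (x i)) (allFin n))

_≥∞_ : ℤ → ℤ∞ → Set
a ≥∞ nothing = Unit
a ≥∞ just b  = b ℤ.≤ a

-- p is a set function with values in ℤ ∪ {-∞}, p(∅) = 0, p(S) finite,
-- supermodular: whenever p(X), p(Y) finite, p(X)+p(Y) ≤ p(X∩Y)+p(X∪Y)
-- (the right-hand side then being finite as well).
record SupermodularFn (n : ℕ) : Set where
  field
    p        : Subset n → ℤ∞
    p-empty  : p ⊥ ≡ just 0ℤ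
    pS       : ℤ
    p-full   : p ⊤ ≡ just pS
    supermod : ∀ X Y a b → p X ≡ just a → p Y ≡ just b →
               Σ ℤ λ c → Σ ℤ λ d →
                 p (X ∩ Y) ≡ just c × p (X ∪ Y) ≡ just d × (a + b) ℤ.≤ (c + d)

InB : ∀ {n} → SupermodularFn n → Vecℤ n → Set
InB {n} P x = x̃ x ⊤ ≡ SupermodularFn.pS P × (∀ (Z : Subset n) → x̃ x Z ≥∞ SupermodularFn.p P Z)

insert↓ : ℤ → List ℤ → List ℤ
insert↓ a [] = a ∷ []
insert↓ a (b ∷ bs) with b ≤? a
... | yes _ = a ∷ b ∷ bs
... | no  _ = b ∷ insert↓ a bs

sort↓ : List ℤ → List ℤ
sort↓ = foldr insert↓ []

_↓ : ∀ {n} → Vecℤ n → List ℤ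
_↓ {n} x = sort↓ (map x (allFin n))

LexLeq : List ℤ → List ℤ → Set
LexLeq []       []       = Unit
LexLeq []       (_ ∷ _)  = Empty
LexLeq (_ ∷ _)  []       = Empty
LexLeq (a ∷ as) (b ∷ bs) = (a ℤ.< b) ⊎ (a ≡ b × LexLeq as bs)

_≤dec_ : ∀ {n} → Vecℤ n → Vecℤ n → Set
x ≤dec y = LexLeq (x ↓) (y ↓)

DecMin : ∀ {n} → SupermodularFn n → Vecℤ n → Set
DecMin P m = InB P m × (∀ y → InB P y → m ≤dec y)

largestSum : ∀ {n} → ℕ → Vecℤ n → ℤ
largestSum k x = sumℤ (take k (x ↓))

SimulMin : ∀ {n} → SupermodularFn n → Vecℤ n → Set
SimulMin {n} P m = InB P m ×
  (∀ (k : ℕ) → 1 ≤ k → k ≤ n → ∀ y → InB P y → largestSum k m ℤ.≤ largestSum k y)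

-- largestSum k x is the maximum of x̃ x Z over the k-element subsets Z, and two sorted lists of
-- equal length whose prefix sums are pointwise ≤ are lexicographically ≤; this gives that a
-- simultaneous minimizer is decreasingly minimal.
--
-- Conversely let m be decreasingly minimal and y ∈ B. Moving a unit from a larger to a smaller
-- component never increases a largest sum. So m admits no transfer m − χ_t + χ_s with
-- m t ≥ m s + 2 in B: it would leave m↓ unchanged but lower Σ m_i². Hence for i with m i ≥ m s + 2
-- some m-tight set contains i but not s. If y s > m s, then y − χ_s + χ_t ∈ B for some t with
-- y t < m t and y t < y s: otherwise the union C of m-tight sets avoiding s and the intersection T
-- of y-tight sets around s blocking each such t satisfy y(T ∖ C) > m(T ∖ C), whereas
-- supermodularity of p gives y(T ∖ C) ≤ m(T ∖ C). Such a transfer does not increase the largest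
-- sums of y and brings y closer to m, so induction on Σ |y i − m i| ends at y = m.

module Submission where

open import Algebra.Properties.CommutativeMonoid.Sum as ℤΣ using ()
open import Data.Bool.Base using (true; false; _∧_; _∨_)
open import Data.Bool.Properties using (∧-zeroʳ; ∨-zeroʳ)
open import Data.Empty using (⊥-elim) renaming (⊥ to Empty)
open import Data.Fin.Base using (Fin; zero; suc)
open import Data.Fin.Properties using (suc-injective; any?; _≟_)
open import Data.Fin.Subset using (Subset; inside; outside; _∩_; _∪_; ⊥; ⊤; ∣_∣; ⋂; ⋃)
open import Data.Fin.Subset.Properties using (∣⊥∣≡0; ∣p∣≤n; anySubset?)
open import Data.Integer.Base as ℤ using (ℤ; 0ℤ; 1ℤ; +_; _+_; _-_; _*_; _≤_; _<_; _≥_)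
import Data.Integer.Properties as ℤ
open import Data.Integer.Properties using (_≤?_)
open import Data.Integer.Tactic.RingSolver using (solve-∀)
open import Data.List.Base using (List; []; _∷_; map; tabulate; allFin; take; length)
open import Data.List.Properties using (map-tabulate; map-∘; map-cong; length-map; length-tabulate)
open import Data.List.Relation.Binary.Permutation.Propositional
  using (_↭_; ↭-refl; ↭-sym; ↭-prep; ↭-swap; ↭-trans; ↭⇒↭ₛ)
open import Data.List.Relation.Binary.Permutation.Propositional.Properties using (↭-length; All-resp-↭; map⁺)
open import Data.List.Relation.Binary.Permutation.Setoid.Properties ℤ.≡-setoid using (foldr-commMonoid)
open import Data.List.Relation.Unary.All as All using (All; []; _∷_)
open import Data.List.Relation.Unary.AllPairs using (AllPairs; []; _∷_)
open import Data.Maybe.Base using (just; nothing)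
open import Data.Nat.Base as ℕ using (ℕ; z≤n; s≤s)
open import Data.Nat.Induction using (<-wellFounded)
import Data.Nat.Properties as ℕ
open import Data.Product.Base using (Σ; _×_; _,_; proj₁; proj₂)
open import Data.Sum.Base using (_⊎_; inj₁; inj₂)
open import Data.Vec.Base using ([]; _∷_; lookup; _[_]≔_)
open import Data.Vec.Functional using (updateAt)
open import Data.Vec.Functional.Properties using (updateAt-updates; updateAt-minimal)
open import Data.Vec.Properties using (lookup-zipWith; lookup-replicate; lookup∘update; lookup∘update′)
open import Function.Base using (id; _∘_)
open import Function.Bundles using (_⇔_; mk⇔)
open import Induction.WellFounded using (Acc; acc)
open import Relation.Binary.PropositionalEquality
open import Relation.Nullary.Decidable using (Dec; yes; no; ¬?; _×-dec_; decidable-stable)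
open import Relation.Nullary.Negation using (¬_)

open import Defs

import Algebra.Properties.Monoid.Sum ℕ.+-0-monoid as ℕΣ
open import Algebra.Properties.CommutativeSemigroup ℤ.+-commutativeSemigroup
  using (x∙yz≈xz∙y; x∙yz≈y∙xz; xy∙z≈xz∙y; xy∙z≈x∙zy; xy∙z≈zy∙x)
open import Algebra.Properties.AbelianGroup ℤ.+-0-abelianGroup
  using () renaming (∙-cancelˡ to +-cancelˡ-≡; ∙-cancelʳ to +-cancelʳ-≡)
open ℤΣ ℤ.+-0-commutativeMonoid using (sum; sum-cong-≗; ∑-distrib-+; sum-replicate-zero)

+-cancelʳ-≤ : ∀ {u v} w → u + w ≤ v + w → u ≤ v
+-cancelʳ-≤ {u} {v} w u+w≤v+w = subst₂ _≤_ (cancel u w) (cancel v w) (ℤ.+-monoˡ-≤ (ℤ.- w) u+w≤v+w)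
  where
  cancel : ∀ a b → (a + b) + ℤ.- b ≡ a
  cancel = solve-∀

+-cancelˡ-≤ : ∀ {u v} w → w + u ≤ w + v → u ≤ v
+-cancelˡ-≤ {u} {v} w w+u≤w+v = +-cancelʳ-≤ w (subst₂ _≤_ (ℤ.+-comm w u) (ℤ.+-comm w v) w+u≤w+v)

≤-from-+-≡ : ∀ {u v α β} → u + α ≡ v + β → β ≤ α → u ≤ v
≤-from-+-≡ {u} {v} {α} {β} u+α≡v+β β≤α =
  +-cancelʳ-≤ α (subst (_≤ v + α) (sym u+α≡v+β) (ℤ.+-monoʳ-≤ v β≤α))

≤-+-squeeze : ∀ {c d u v} → c ≤ u → d ≤ v → u + v ≤ c + d → c ≡ u × d ≡ v
≤-+-squeeze {c} {d} {u} {v} c≤u d≤v u+v≤c+d =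
  ℤ.≤-antisym c≤u (+-cancelʳ-≤ v (ℤ.≤-trans u+v≤c+d (ℤ.+-monoʳ-≤ c d≤v))) ,
  ℤ.≤-antisym d≤v (+-cancelˡ-≤ u (ℤ.≤-trans u+v≤c+d (ℤ.+-monoˡ-≤ d c≤u)))

<⇒0<- : ∀ {i j} → i < j → 0ℤ < j - i
<⇒0<- {i} {j} i<j = subst (_< j - i) (ℤ.+-inverseʳ i) (ℤ.+-monoˡ-< (ℤ.- i) i<j)

<⇒-<0 : ∀ {i j} → i < j → i - j < 0ℤ
<⇒-<0 {i} {j} i<j = subst (i - j <_) (ℤ.+-inverseʳ j) (ℤ.+-monoˡ-< (ℤ.- j) i<j)

+1<⇒< : ∀ {a b} → a + 1ℤ < b → a < b
+1<⇒< {a} a+1<b = ℤ.≤-<-trans (ℤ.i≤i+j a 1ℤ) a+1<b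

<⇒+1≤ : ∀ {a b} → a < b → a + 1ℤ ≤ b
<⇒+1≤ {a} a<b = subst (_≤ _) (ℤ.+-comm 1ℤ a) (ℤ.i<j⇒suc[i]≤j a<b)

squares-transfer-< : ∀ {a b} → a + 1ℤ < b → (b - 1ℤ) * (b - 1ℤ) + (a + 1ℤ) * (a + 1ℤ) < b * b + a * a
squares-transfer-< {a} {b} a+1<b = subst₂ _<_ (ℤ.+-identityʳ u) (expand a b) (ℤ.+-monoʳ-< u 0<2d)
  where
  u d : ℤ
  u = (b - 1ℤ) * (b - 1ℤ) + (a + 1ℤ) * (a + 1ℤ)
  d = b - (a + 1ℤ)
  0<2d : 0ℤ < d + d
  0<2d = ℤ.+-mono-< (<⇒0<- a+1<b) (<⇒0<- a+1<b)
  expand : ∀ a b → ((b - 1ℤ) * (b - 1ℤ) + (a + 1ℤ) * (a + 1ℤ)) + ((b - (a + 1ℤ)) + (b - (a + 1ℤ))) ≡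
                   b * b + a * a
  expand = solve-∀

∣-1∣<∣∣ : ∀ {d} → 0ℤ < d → ℤ.∣ d - 1ℤ ∣ ℕ.< ℤ.∣ d ∣
∣-1∣<∣∣ {+ ℕ.suc k} _ = ℕ.n<1+n k
∣-1∣<∣∣ {+ ℕ.zero}  (ℤ.+<+ ())

∣+1∣<∣∣ : ∀ {d} → d < 0ℤ → ℤ.∣ d + 1ℤ ∣ ℕ.< ℤ.∣ d ∣
∣+1∣<∣∣ {ℤ.-[1+ ℕ.zero ]}  _ = s≤s z≤n
∣+1∣<∣∣ {ℤ.-[1+ ℕ.suc k ]} _ = ℕ.n<1+n (ℕ.suc k)
∣+1∣<∣∣ {+ k}              (ℤ.+<+ ())

-- Sums over Fin n and unit transfers

sumℤ-allFin : ∀ {n} (f : Fin n → ℤ) → sumℤ (map f (allFin n)) ≡ sum f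
sumℤ-allFin f = trans (cong sumℤ (map-tabulate id f)) (sumℤ-tabulate f)
  where
  sumℤ-tabulate : ∀ {n} (f : Fin n → ℤ) → sumℤ (tabulate f) ≡ sum f
  sumℤ-tabulate {ℕ.zero}  f = refl
  sumℤ-tabulate {ℕ.suc n} f = cong (_+_ (f zero)) (sumℤ-tabulate (f ∘ suc))

sum-mono-≤ : ∀ {n} {f g : Fin n → ℤ} → (∀ i → f i ≤ g i) → sum f ≤ sum g
sum-mono-≤ {ℕ.zero}  f≤g = ℤ.≤-refl
sum-mono-≤ {ℕ.suc n} f≤g = ℤ.+-mono-≤ (f≤g zero) (sum-mono-≤ (f≤g ∘ suc))

sum-mono-< : ∀ {n} {f g : Fin n → ℤ} → (∀ i → f i ≤ g i) → ∀ i → f i < g i → sum f < sum g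
sum-mono-< f≤g zero    fi<gi = ℤ.+-mono-<-≤ fi<gi (sum-mono-≤ (f≤g ∘ suc))
sum-mono-< f≤g (suc i) fi<gi = ℤ.+-mono-≤-< (f≤g zero) (sum-mono-< (f≤g ∘ suc) i fi<gi)

sum-cong-except : ∀ {n} {f g : Fin n → ℤ} i → (∀ j → j ≢ i → f j ≡ g j) →
                  sum f + g i ≡ sum g + f i
sum-cong-except {f = f} {g} zero f≡g = begin
  (f zero + sum (f ∘ suc)) + g zero ≡⟨ cong (λ s → (f zero + s) + g zero) (sum-cong-≗ λ j → f≡g (suc j) λ ()) ⟩
  (f zero + sum (g ∘ suc)) + g zero ≡⟨ xy∙z≈zy∙x (f zero) (sum (g ∘ suc)) (g zero) ⟩
  (g zero + sum (g ∘ suc)) + f zero ∎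
  where open ≡-Reasoning
sum-cong-except {f = f} {g} (suc i) f≡g = begin
  (f zero + sum (f ∘ suc)) + g (suc i) ≡⟨ ℤ.+-assoc (f zero) _ _ ⟩
  f zero + (sum (f ∘ suc) + g (suc i)) ≡⟨ cong₂ _+_ (f≡g zero λ ())
                                            (sum-cong-except i λ j j≢i → f≡g (suc j) (j≢i ∘ suc-injective)) ⟩
  g zero + (sum (g ∘ suc) + f (suc i)) ≡⟨ ℤ.+-assoc (g zero) _ _ ⟨
  (g zero + sum (g ∘ suc)) + f (suc i) ∎
  where open ≡-Reasoning

ℕsum-mono-≤ : ∀ {n} {f g : Fin n → ℕ} → (∀ i → f i ℕ.≤ g i) → ℕΣ.sum f ℕ.≤ ℕΣ.sum g
ℕsum-mono-≤ {ℕ.zero}  f≤g = z≤n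
ℕsum-mono-≤ {ℕ.suc n} f≤g = ℕ.+-mono-≤ (f≤g zero) (ℕsum-mono-≤ (f≤g ∘ suc))

ℕsum-mono-< : ∀ {n} {f g : Fin n → ℕ} → (∀ i → f i ℕ.≤ g i) → ∀ i → f i ℕ.< g i → ℕΣ.sum f ℕ.< ℕΣ.sum g
ℕsum-mono-< f≤g zero    fi<gi = ℕ.+-mono-<-≤ fi<gi (ℕsum-mono-≤ (f≤g ∘ suc))
ℕsum-mono-< f≤g (suc i) fi<gi = ℕ.+-mono-≤-< (f≤g zero) (ℕsum-mono-< (f≤g ∘ suc) i fi<gi)

transfer : ∀ {n} → Vecℤ n → Fin n → Fin n → Vecℤ n
transfer x a b = updateAt (updateAt x a (_- 1ℤ)) b (_+ 1ℤ)

module _ {n} (x : Vecℤ n) {a b : Fin n} (a≢b : a ≢ b) where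

  transfer-source : transfer x a b a ≡ x a - 1ℤ
  transfer-source = trans (updateAt-minimal a b _ a≢b) (updateAt-updates a x)

  transfer-target : transfer x a b b ≡ x b + 1ℤ
  transfer-target = trans (updateAt-updates b _) (cong (_+ 1ℤ) (updateAt-minimal b a x (a≢b ∘ sym)))

  transfer-other : ∀ {i} → i ≢ a → i ≢ b → transfer x a b i ≡ x i
  transfer-other {i} i≢a i≢b = trans (updateAt-minimal i b _ i≢b) (updateAt-minimal i a x i≢a)

  sum-transfer : (g : Fin n → ℤ → ℤ) →
                 sum (λ i → g i (transfer x a b i)) + (g a (x a) + g b (x b)) ≡
                 sum (λ i → g i (x i)) + (g a (x a - 1ℤ) + g b (x b + 1ℤ))
  sum-transfer g = begin
    T + (A + B)   ≡⟨ x∙yz≈xz∙y T A B ⟩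
    (T + B) + A   ≡⟨ cong (_+ A) at-b ⟩
    (X₁ + B′) + A ≡⟨ xy∙z≈xz∙y X₁ B′ A ⟩
    (X₁ + A) + B′ ≡⟨ cong (_+ B′) at-a ⟩
    (X + A′) + B′ ≡⟨ ℤ.+-assoc X A′ B′ ⟩
    X + (A′ + B′) ∎
    where
    open ≡-Reasoning
    x₁ : Vecℤ n
    x₁ = updateAt x a (_- 1ℤ)
    T X₁ X A B A′ B′ : ℤ
    T  = sum (λ i → g i (transfer x a b i))
    X₁ = sum (λ i → g i (x₁ i))
    X  = sum (λ i → g i (x i))
    A  = g a (x a)
    B  = g b (x b)
    A′ = g a (x a - 1ℤ)
    B′ = g b (x b + 1ℤ)
    at-b : T + B ≡ X₁ + B′
    at-b = begin
      T + B                          ≡⟨ cong (λ v → T + g b v) (updateAt-minimal b a x (a≢b ∘ sym)) ⟨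
      T + g b (x₁ b)                 ≡⟨ sum-cong-except b (λ j j≢b → cong (g j) (updateAt-minimal j b x₁ j≢b)) ⟩
      X₁ + g b (transfer x a b b)    ≡⟨ cong (λ v → X₁ + g b v) transfer-target ⟩
      X₁ + B′                        ∎
    at-a : X₁ + A ≡ X + A′
    at-a = trans (sum-cong-except a (λ j j≢a → cong (g j) (updateAt-minimal j a x j≢a)))
                 (cong (λ v → X + g a v) (updateAt-updates a x))

≢-from-< : ∀ {n} (x : Vecℤ n) {i j} → x i < x j → i ≢ j
≢-from-< x xi<xj refl = ℤ.<-irrefl refl xi<xj

distance : ∀ {n} → Vecℤ n → Vecℤ n → ℕ
distance x y = ℕΣ.sum (λ i → ℤ.∣ y i - x i ∣)

distance-transfer : ∀ {n} {x y : Vecℤ n} {s t} → x s < y s → y t < x t →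
                    distance x (transfer y s t) ℕ.< distance x y
distance-transfer {x = x} {y} {s} {t} xs<ys yt<xt = ℕsum-mono-< pointwise s at-s
  where
  s≢t : s ≢ t
  s≢t refl = ℤ.<-asym xs<ys yt<xt
  shift : ∀ a e b → (a + e) - b ≡ (a - b) + e
  shift = solve-∀
  at-s : ℤ.∣ transfer y s t s - x s ∣ ℕ.< ℤ.∣ y s - x s ∣
  at-s rewrite transfer-source y s≢t | shift (y s) (ℤ.- 1ℤ) (x s) = ∣-1∣<∣∣ (<⇒0<- xs<ys)
  at-t : ℤ.∣ transfer y s t t - x t ∣ ℕ.< ℤ.∣ y t - x t ∣
  at-t rewrite transfer-target y s≢t | shift (y t) 1ℤ (x t) = ∣+1∣<∣∣ (<⇒-<0 yt<xt)
  pointwise : ∀ i → ℤ.∣ transfer y s t i - x i ∣ ℕ.≤ ℤ.∣ y i - x i ∣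
  pointwise i with i ≟ s | i ≟ t
  ... | yes refl | _        = ℕ.<⇒≤ at-s
  ... | no _     | yes refl = ℕ.<⇒≤ at-t
  ... | no i≢s   | no i≢t   = ℕ.≤-reflexive (cong (λ v → ℤ.∣ v - x i ∣) (transfer-other y s≢t i≢s i≢t))

-- Subsets and the weighted sums x̃

inside≢outside : inside ≢ outside
inside≢outside ()

lookup-⋂-inside : ∀ {k n} (F : Fin k → Subset n) i → (∀ j → lookup (F j) i ≡ inside) →
                  lookup (⋂ (tabulate F)) i ≡ inside
lookup-⋂-inside {ℕ.zero}  F i _    = lookup-replicate i inside
lookup-⋂-inside {ℕ.suc k} F i i∈F rewrite lookup-zipWith _∧_ i (F zero) (⋂ (tabulate (F ∘ suc))) | i∈F zero =
  lookup-⋂-inside (F ∘ suc) i (i∈F ∘ suc)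

lookup-⋂-outside : ∀ {k n} (F : Fin k → Subset n) i j → lookup (F j) i ≡ outside →
                   lookup (⋂ (tabulate F)) i ≡ outside
lookup-⋂-outside F i zero i∉Fj rewrite lookup-zipWith _∧_ i (F zero) (⋂ (tabulate (F ∘ suc))) | i∉Fj = refl
lookup-⋂-outside F i (suc j) i∉Fj
  rewrite lookup-zipWith _∧_ i (F zero) (⋂ (tabulate (F ∘ suc))) | lookup-⋂-outside (F ∘ suc) i j i∉Fj =
  ∧-zeroʳ (lookup (F zero) i)

lookup-⋃-inside : ∀ {k n} (F : Fin k → Subset n) i j → lookup (F j) i ≡ inside →
                  lookup (⋃ (tabulate F)) i ≡ inside
lookup-⋃-inside F i zero i∈Fj rewrite lookup-zipWith _∨_ i (F zero) (⋃ (tabulate (F ∘ suc))) | i∈Fj = refl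
lookup-⋃-inside F i (suc j) i∈Fj
  rewrite lookup-zipWith _∨_ i (F zero) (⋃ (tabulate (F ∘ suc))) | lookup-⋃-inside (F ∘ suc) i j i∈Fj =
  ∨-zeroʳ (lookup (F zero) i)

lookup-⋃-outside : ∀ {k n} (F : Fin k → Subset n) i → (∀ j → lookup (F j) i ≡ outside) →
                   lookup (⋃ (tabulate F)) i ≡ outside
lookup-⋃-outside {ℕ.zero}  F i _    = lookup-replicate i outside
lookup-⋃-outside {ℕ.suc k} F i i∉F rewrite lookup-zipWith _∨_ i (F zero) (⋃ (tabulate (F ∘ suc))) | i∉F zero =
  lookup-⋃-outside (F ∘ suc) i (i∉F ∘ suc)

allSubsets? : ∀ {n} {Q : Subset n → Set} → (∀ Z → Dec (Q Z)) → Dec (∀ Z → Q Z)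
allSubsets? Q? with anySubset? (¬? ∘ Q?)
... | yes (Z , ¬QZ) = no (λ Q-everywhere → ¬QZ (Q-everywhere Z))
... | no  ¬∃¬Q      = yes (λ Z → decidable-stable (Q? Z) (λ ¬QZ → ¬∃¬Q (Z , ¬QZ)))

_≥∞?_ : ∀ a v → Dec (a ≥∞ v)
a ≥∞? nothing = yes _
a ≥∞? just b  = b ≤? a

replace : ∀ {n} → Subset n → Fin n → Fin n → Subset n
replace Z b a = (Z [ b ]≔ outside) [ a ]≔ inside

x̃-sum : ∀ {n} (x : Vecℤ n) Z → x̃ x Z ≡ sum (λ i → weight (lookup Z i) (x i))
x̃-sum x Z = sumℤ-allFin (λ i → weight (lookup Z i) (x i))

x̃-∷ : ∀ {n} (x : Vecℤ (ℕ.suc n)) s Z → x̃ x (s ∷ Z) ≡ weight s (x zero) + x̃ (x ∘ suc) Z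
x̃-∷ x s Z = trans (x̃-sum x (s ∷ Z)) (cong (_+_ (weight s (x zero))) (sym (x̃-sum (x ∘ suc) Z)))

x̃-⊤ : ∀ {n} (x : Vecℤ n) → x̃ x ⊤ ≡ sum x
x̃-⊤ x = trans (x̃-sum x ⊤) (sum-cong-≗ λ i → cong (λ s → weight s (x i)) (lookup-replicate i inside))

x̃-⊥ : ∀ {n} (x : Vecℤ n) → x̃ x ⊥ ≡ 0ℤ
x̃-⊥ {n} x = trans (x̃-sum x ⊥) (trans (sum-cong-≗ λ i → cong (λ s → weight s (x i)) (lookup-replicate i outside))
                                      (sum-replicate-zero n))

x̃-modular : ∀ {n} (x : Vecℤ n) X Y → x̃ x (X ∩ Y) + x̃ x (X ∪ Y) ≡ x̃ x X + x̃ x Y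
x̃-modular x X Y = begin
  x̃ x (X ∩ Y) + x̃ x (X ∪ Y) ≡⟨ cong₂ _+_ (x̃-sum x (X ∩ Y)) (x̃-sum x (X ∪ Y)) ⟩
  sum (w (X ∩ Y)) + sum (w (X ∪ Y)) ≡⟨ ∑-distrib-+ (w (X ∩ Y)) (w (X ∪ Y)) ⟨
  sum (λ i → w (X ∩ Y) i + w (X ∪ Y) i) ≡⟨ sum-cong-≗ pointwise ⟩
  sum (λ i → w X i + w Y i) ≡⟨ ∑-distrib-+ (w X) (w Y) ⟩
  sum (w X) + sum (w Y) ≡⟨ cong₂ _+_ (x̃-sum x X) (x̃-sum x Y) ⟨
  x̃ x X + x̃ x Y ∎
  where
  open ≡-Reasoning
  w : Subset _ → Fin _ → ℤ
  w Z i = weight (lookup Z i) (x i)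
  weight-modular : ∀ s t v → weight (s ∧ t) v + weight (s ∨ t) v ≡ weight s v + weight t v
  weight-modular true  t     v = ℤ.+-comm (weight t v) v
  weight-modular false t     v = refl
  pointwise : ∀ i → w (X ∩ Y) i + w (X ∪ Y) i ≡ w X i + w Y i
  pointwise i rewrite lookup-zipWith _∧_ i X Y | lookup-zipWith _∨_ i X Y =
    weight-modular (lookup X i) (lookup Y i) (x i)

x̃-update : ∀ {n} (x : Vecℤ n) Z i s → x̃ x (Z [ i ]≔ s) + weight (lookup Z i) (x i) ≡ x̃ x Z + weight s (x i)
x̃-update x Z i s = begin
  x̃ x (Z [ i ]≔ s) + weight (lookup Z i) (x i) ≡⟨ cong₂ _+_ (x̃-sum x (Z [ i ]≔ s)) refl ⟩
  sum (λ j → weight (lookup (Z [ i ]≔ s) j) (x j)) + weight (lookup Z i) (x i)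
    ≡⟨ sum-cong-except i (λ j j≢i → cong (λ t → weight t (x j)) (lookup∘update′ j≢i Z s)) ⟩
  sum (λ j → weight (lookup Z j) (x j)) + weight (lookup (Z [ i ]≔ s) i) (x i)
    ≡⟨ cong₂ _+_ (sym (x̃-sum x Z)) (cong (λ t → weight t (x i)) (lookup∘update i Z s)) ⟩
  x̃ x Z + weight s (x i) ∎
  where open ≡-Reasoning

x̃-transfer : ∀ {n} (x : Vecℤ n) {a b} → a ≢ b → ∀ Z →
             x̃ (transfer x a b) Z + weight (lookup Z a) 1ℤ ≡ x̃ x Z + weight (lookup Z b) 1ℤ
x̃-transfer x {a} {b} a≢b Z = begin
  X′ + α ≡⟨ rearrange₁ X′ α A B ⟩
  (X′ + (A + B)) + (α - (A + B)) ≡⟨ cong (λ u → u + (α - (A + B))) summed ⟩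
  (X + ((A - α) + (B + β))) + (α - (A + B)) ≡⟨ rearrange₂ X A B α β ⟩
  X + β ∎
  where
  open ≡-Reasoning
  w : Fin _ → ℤ → ℤ
  w i = weight (lookup Z i)
  X′ X A B α β : ℤ
  X′ = x̃ (transfer x a b) Z
  X  = x̃ x Z
  A  = w a (x a)
  B  = w b (x b)
  α  = w a 1ℤ
  β  = w b 1ℤ
  weight-pred : ∀ s u → weight s (u - 1ℤ) ≡ weight s u - weight s 1ℤ
  weight-pred inside  u = refl
  weight-pred outside u = refl
  weight-suc : ∀ s u → weight s (u + 1ℤ) ≡ weight s u + weight s 1ℤ
  weight-suc inside  u = refl
  weight-suc outside u = refl
  summed : X′ + (A + B) ≡ X + ((A - α) + (B + β))
  summed = trans (cong (_+ (A + B)) (x̃-sum (transfer x a b) Z))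
             (trans (sum-transfer x a≢b w)
               (cong₂ _+_ (sym (x̃-sum x Z))
                          (cong₂ _+_ (weight-pred (lookup Z a) (x a)) (weight-suc (lookup Z b) (x b)))))
  rearrange₁ : ∀ u α A B → u + α ≡ (u + (A + B)) + (α - (A + B))
  rearrange₁ = solve-∀
  rearrange₂ : ∀ u A B α β → (u + ((A - α) + (B + β))) + (α - (A + B)) ≡ u + β
  rearrange₂ = solve-∀

x̃-transfer-⊤ : ∀ {n} (x : Vecℤ n) {a b} → a ≢ b → x̃ (transfer x a b) ⊤ ≡ x̃ x ⊤
x̃-transfer-⊤ x {a} {b} a≢b = +-cancelʳ-≡ 1ℤ _ _
  (subst₂ (λ s t → x̃ (transfer x a b) ⊤ + weight s 1ℤ ≡ x̃ x ⊤ + weight t 1ℤ)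
          (lookup-replicate a inside) (lookup-replicate b inside) (x̃-transfer x a≢b ⊤))

x̃-replace : ∀ {n} (x : Vecℤ n) {Z a b} → lookup Z a ≡ outside → lookup Z b ≡ inside →
            x̃ x (replace Z b a) + x b ≡ x̃ x Z + x a
x̃-replace x {Z} {a} {b} a∉Z b∈Z = begin
  x̃ x Z′ + x b            ≡⟨ cong (_+ x b) (ℤ.+-identityʳ (x̃ x Z′)) ⟨
  (x̃ x Z′ + 0ℤ) + x b     ≡⟨ cong (_+ x b) added ⟩
  (x̃ x Z₁ + x a) + x b    ≡⟨ xy∙z≈xz∙y (x̃ x Z₁) (x a) (x b) ⟩
  (x̃ x Z₁ + x b) + x a    ≡⟨ cong (_+ x a) removed ⟩
  (x̃ x Z + 0ℤ) + x a      ≡⟨ cong (_+ x a) (ℤ.+-identityʳ (x̃ x Z)) ⟩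
  x̃ x Z + x a             ∎
  where
  open ≡-Reasoning
  Z₁ Z′ : Subset _
  Z₁ = Z [ b ]≔ outside
  Z′ = replace Z b a
  a≢b : a ≢ b
  a≢b refl with trans (sym a∉Z) b∈Z
  ... | ()
  removed : x̃ x Z₁ + x b ≡ x̃ x Z + 0ℤ
  removed = subst (λ s → x̃ x Z₁ + weight s (x b) ≡ x̃ x Z + 0ℤ) b∈Z (x̃-update x Z b outside)
  added : x̃ x Z′ + 0ℤ ≡ x̃ x Z₁ + x a
  added = subst (λ s → x̃ x Z′ + weight s (x a) ≡ x̃ x Z₁ + x a)
                (trans (lookup∘update′ a≢b Z outside) a∉Z) (x̃-update x Z₁ a inside)

∣∣-as-x̃ : ∀ {n} (Z : Subset n) → + ∣ Z ∣ ≡ x̃ (λ _ → 1ℤ) Z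
∣∣-as-x̃ []            = refl
∣∣-as-x̃ (inside ∷ Z)  = trans (cong (_+_ 1ℤ) (∣∣-as-x̃ Z)) (sym (x̃-∷ (λ _ → 1ℤ) inside Z))
∣∣-as-x̃ (outside ∷ Z) = trans (∣∣-as-x̃ Z) (trans (sym (ℤ.+-identityˡ _)) (sym (x̃-∷ (λ _ → 1ℤ) outside Z)))

∣replace∣ : ∀ {n} {Z : Subset n} {a b} → lookup Z a ≡ outside → lookup Z b ≡ inside →
            ∣ replace Z b a ∣ ≡ ∣ Z ∣
∣replace∣ {Z = Z} {a} {b} a∉Z b∈Z = ℤ.+-injective (+-cancelʳ-≡ 1ℤ _ _ (begin
  + ∣ replace Z b a ∣ + 1ℤ              ≡⟨ cong (_+ 1ℤ) (∣∣-as-x̃ (replace Z b a)) ⟩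
  x̃ (λ _ → 1ℤ) (replace Z b a) + 1ℤ    ≡⟨ x̃-replace (λ _ → 1ℤ) {Z} {a} {b} a∉Z b∈Z ⟩
  x̃ (λ _ → 1ℤ) Z + 1ℤ                  ≡⟨ cong (_+ 1ℤ) (∣∣-as-x̃ Z) ⟨
  + ∣ Z ∣ + 1ℤ                           ∎))
  where open ≡-Reasoning

-- x̃ x (T ∖ C) < x̃ y (T ∖ C), with both sides moved so that no subtraction occurs.
x̃-∖-< : ∀ {n} {x y : Vecℤ n} {T C s} →
        (∀ i → lookup T i ≡ inside → lookup C i ≡ outside → x i ≤ y i) →
        lookup T s ≡ inside → lookup C s ≡ outside → x s < y s →
        x̃ y (T ∩ C) + x̃ x T < x̃ y T + x̃ x (T ∩ C)
x̃-∖-< {x = x} {y} {T} {C} {s} x≤y s∈T s∉C xs<ys = begin-strict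
  x̃ y (T ∩ C) + x̃ x T                    ≡⟨ cong₂ _+_ (x̃-sum y (T ∩ C)) (x̃-sum x T) ⟩
  sum (w (T ∩ C) y) + sum (w T x)        ≡⟨ ∑-distrib-+ (w (T ∩ C) y) (w T x) ⟨
  sum (λ i → w (T ∩ C) y i + w T x i)    <⟨ sum-mono-< pointwise-≤ s pointwise-< ⟩
  sum (λ i → w T y i + w (T ∩ C) x i)    ≡⟨ ∑-distrib-+ (w T y) (w (T ∩ C) x) ⟩
  sum (w T y) + sum (w (T ∩ C) x)        ≡⟨ cong₂ _+_ (x̃-sum y T) (x̃-sum x (T ∩ C)) ⟨
  x̃ y T + x̃ x (T ∩ C)                    ∎
  where
  open ℤ.≤-Reasoning
  w : Subset _ → Vecℤ _ → Fin _ → ℤ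
  w Z z i = weight (lookup Z i) (z i)
  pointwise-≤ : ∀ i → w (T ∩ C) y i + w T x i ≤ w T y i + w (T ∩ C) x i
  pointwise-≤ i rewrite lookup-zipWith _∧_ i T C with lookup T i in i∈T | lookup C i in i∉C
  ... | outside | _       = ℤ.≤-refl
  ... | inside  | inside  = ℤ.≤-refl
  ... | inside  | outside = subst₂ _≤_ (sym (ℤ.+-identityˡ (x i))) (sym (ℤ.+-identityʳ (y i))) (x≤y i i∈T i∉C)
  pointwise-< : w (T ∩ C) y s + w T x s < w T y s + w (T ∩ C) x s
  pointwise-< rewrite lookup-zipWith _∧_ s T C | s∈T | s∉C =
    subst₂ _<_ (sym (ℤ.+-identityˡ (x s))) (sym (ℤ.+-identityʳ (y s))) xs<ys

-- Decreasing sorting, prefix sums and largest sums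

Sorted↓ : List ℤ → Set
Sorted↓ = AllPairs _≥_

prefixSum : ℕ → List ℤ → ℤ
prefixSum k l = sumℤ (take k l)

insert↓-↭ : ∀ a l → insert↓ a l ↭ a ∷ l
insert↓-↭ a []       = ↭-refl
insert↓-↭ a (b ∷ bs) with b ≤? a
... | yes _ = ↭-refl
... | no  _ = ↭-trans (↭-prep b (insert↓-↭ a bs)) (↭-swap b a ↭-refl)

sort↓-↭ : ∀ l → sort↓ l ↭ l
sort↓-↭ []      = ↭-refl
sort↓-↭ (a ∷ l) = ↭-trans (insert↓-↭ a (sort↓ l)) (↭-prep a (sort↓-↭ l))

insert↓-sorted : ∀ a {l} → Sorted↓ l → Sorted↓ (insert↓ a l)
insert↓-sorted a {[]}     []                 = [] ∷ []
insert↓-sorted a {b ∷ bs} sorted@(b≥bs ∷ bs-sorted) with b ≤? a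
... | yes b≤a = (b≤a ∷ All.map (λ c≤b → ℤ.≤-trans c≤b b≤a) b≥bs) ∷ sorted
... | no  b≰a = All-resp-↭ (↭-sym (insert↓-↭ a bs)) (ℤ.<⇒≤ (ℤ.≰⇒> b≰a) ∷ b≥bs) ∷ insert↓-sorted a bs-sorted

sort↓-sorted : ∀ l → Sorted↓ (sort↓ l)
sort↓-sorted []      = []
sort↓-sorted (a ∷ l) = insert↓-sorted a (sort↓-sorted l)

sumℤ-↭ : ∀ {l l′} → l ↭ l′ → sumℤ l ≡ sumℤ l′
sumℤ-↭ l↭l′ = foldr-commMonoid ℤ.+-0-isCommutativeMonoid (↭⇒↭ₛ l↭l′)

prefixSum-suc-≤ : ∀ {a} j l → All (_≤ a) l → ℕ.suc j ℕ.≤ length l → prefixSum (ℕ.suc j) l ≤ a + prefixSum j l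
prefixSum-suc-≤ {a} ℕ.zero    (c ∷ cs) (c≤a ∷ _)    _         = ℤ.+-monoˡ-≤ 0ℤ c≤a
prefixSum-suc-≤ {a} (ℕ.suc j) (c ∷ cs) (_ ∷ cs≤a) (s≤s j<∣cs∣) = begin
  c + prefixSum (ℕ.suc j) cs ≤⟨ ℤ.+-monoʳ-≤ c (prefixSum-suc-≤ j cs cs≤a j<∣cs∣) ⟩
  c + (a + prefixSum j cs)   ≡⟨ x∙yz≈y∙xz c a (prefixSum j cs) ⟩
  a + (c + prefixSum j cs)   ∎
  where open ℤ.≤-Reasoning

prefixSum-insert↓ : ∀ a {k l} → Sorted↓ l → k ℕ.≤ length l → prefixSum k l ≤ prefixSum k (insert↓ a l)
prefixSum-insert↓ a {ℕ.zero}  {l}      _ _ = ℤ.≤-refl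
prefixSum-insert↓ a {ℕ.suc k} {b ∷ bs} (b≥bs ∷ bs-sorted) (s≤s k≤∣bs∣) with b ≤? a
... | yes b≤a = prefixSum-suc-≤ k (b ∷ bs) (b≤a ∷ All.map (λ c≤b → ℤ.≤-trans c≤b b≤a) b≥bs) (s≤s k≤∣bs∣)
... | no  _   = ℤ.+-monoʳ-≤ b (prefixSum-insert↓ a bs-sorted k≤∣bs∣)

prefixSum-insert↓-head : ∀ a k l → a + prefixSum k l ≤ prefixSum (ℕ.suc k) (insert↓ a l)
prefixSum-insert↓-head a k [] = ℤ.≤-refl
prefixSum-insert↓-head a k (b ∷ bs) with b ≤? a
... | yes _ = ℤ.≤-refl
prefixSum-insert↓-head a ℕ.zero    (b ∷ bs) | no b≰a = ℤ.+-monoˡ-≤ 0ℤ (ℤ.<⇒≤ (ℤ.≰⇒> b≰a))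
prefixSum-insert↓-head a (ℕ.suc k) (b ∷ bs) | no _   = begin
  a + (b + prefixSum k bs)                 ≡⟨ x∙yz≈y∙xz a b (prefixSum k bs) ⟩
  b + (a + prefixSum k bs)                 ≤⟨ ℤ.+-monoʳ-≤ b (prefixSum-insert↓-head a k bs) ⟩
  b + prefixSum (ℕ.suc k) (insert↓ a bs)   ∎
  where open ℤ.≤-Reasoning

prefixSum-insert↓-cases : ∀ a k l →
  prefixSum (ℕ.suc k) (insert↓ a l) ≡ a + prefixSum k l ⊎
  (prefixSum (ℕ.suc k) (insert↓ a l) ≡ prefixSum (ℕ.suc k) l × ℕ.suc k ℕ.≤ length l)
prefixSum-insert↓-cases a k [] = inj₁ refl
prefixSum-insert↓-cases a k (b ∷ bs) with b ≤? a
... | yes _ = inj₁ refl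
prefixSum-insert↓-cases a ℕ.zero    (b ∷ bs) | no _ = inj₂ (refl , s≤s z≤n)
prefixSum-insert↓-cases a (ℕ.suc k) (b ∷ bs) | no _ with prefixSum-insert↓-cases a k bs
... | inj₁ enters = inj₁ (trans (cong (_+_ b) enters) (x∙yz≈y∙xz b a (prefixSum k bs)))
... | inj₂ (unchanged , k<∣bs∣) = inj₂ (cong (_+_ b) unchanged , s≤s k<∣bs∣)

LexLeq-from-prefixSum : ∀ as bs → length as ≡ length bs →
  (∀ k → 1 ℕ.≤ k → k ℕ.≤ length as → prefixSum k as ≤ prefixSum k bs) → LexLeq as bs
LexLeq-from-prefixSum []       []       _ _ = _
LexLeq-from-prefixSum (a ∷ as) (b ∷ bs) ∣as∣≡∣bs∣ as≤bs with a ℤ.<? b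
... | yes a<b = inj₁ a<b
... | no  a≮b = inj₂ (a≡b , LexLeq-from-prefixSum as bs (ℕ.suc-injective ∣as∣≡∣bs∣) tail≤)
  where
  a≡b : a ≡ b
  a≡b = ℤ.≤-antisym (+-cancelʳ-≤ 0ℤ (as≤bs 1 (s≤s z≤n) (s≤s z≤n))) (ℤ.≮⇒≥ a≮b)
  tail≤ : ∀ k → 1 ℕ.≤ k → k ℕ.≤ length as → prefixSum k as ≤ prefixSum k bs
  tail≤ k _ k≤∣as∣ = +-cancelˡ-≤ a (subst (λ c → a + prefixSum k as ≤ c + prefixSum k bs) (sym a≡b)
                                       (as≤bs (ℕ.suc k) (s≤s z≤n) (s≤s k≤∣as∣)))

LexLeq-prefixSum-≥⇒≡ : ∀ as bs → LexLeq as bs →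
  (∀ k → 1 ℕ.≤ k → k ℕ.≤ length as → prefixSum k bs ≤ prefixSum k as) → as ≡ bs
LexLeq-prefixSum-≥⇒≡ []       []       _ _ = refl
LexLeq-prefixSum-≥⇒≡ (a ∷ as) (b ∷ bs) (inj₁ a<b) bs≤as =
  ⊥-elim (ℤ.<⇒≱ a<b (+-cancelʳ-≤ 0ℤ (bs≤as 1 (s≤s z≤n) (s≤s z≤n))))
LexLeq-prefixSum-≥⇒≡ (a ∷ as) (.a ∷ bs) (inj₂ (refl , as≤bs)) bs≤as =
  cong (a ∷_) (LexLeq-prefixSum-≥⇒≡ as bs as≤bs
    (λ k _ k≤∣as∣ → +-cancelˡ-≤ a (bs≤as (ℕ.suc k) (s≤s z≤n) (s≤s k≤∣as∣))))

↓-↭ : ∀ {n} (x : Vecℤ n) → x ↓ ↭ map x (allFin n)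
↓-↭ {n} x = sort↓-↭ (map x (allFin n))

↓-sorted : ∀ {n} (x : Vecℤ n) → Sorted↓ (x ↓)
↓-sorted {n} x = sort↓-sorted (map x (allFin n))

length-↓ : ∀ {n} (x : Vecℤ n) → length (x ↓) ≡ n
length-↓ {n} x = trans (↭-length (↓-↭ x)) (trans (length-map x (allFin n)) (length-tabulate id))

↓-suc : ∀ {n} (x : Vecℤ (ℕ.suc n)) → x ↓ ≡ insert↓ (x zero) ((x ∘ suc) ↓)
↓-suc {n} x = cong (insert↓ (x zero) ∘ sort↓)
  (trans (map-tabulate suc x) (sym (map-tabulate id (x ∘ suc))))

↓-cong : ∀ {n} {x y : Vecℤ n} → (∀ i → x i ≡ y i) → x ↓ ≡ y ↓
↓-cong {n} x≗y = cong sort↓ (map-cong x≗y (allFin n))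

sumℤ-map-↓ : ∀ {n} (g : ℤ → ℤ) (x : Vecℤ n) → sumℤ (map g (x ↓)) ≡ sum (g ∘ x)
sumℤ-map-↓ {n} g x = begin
  sumℤ (map g (x ↓))                ≡⟨ sumℤ-↭ (map⁺ g (↓-↭ x)) ⟩
  sumℤ (map g (map x (allFin n)))   ≡⟨ cong sumℤ (map-∘ (allFin n)) ⟨
  sumℤ (map (g ∘ x) (allFin n))     ≡⟨ sumℤ-allFin (g ∘ x) ⟩
  sum (g ∘ x)                       ∎
  where open ≡-Reasoning

x̃-≤-largestSum : ∀ {n} (x : Vecℤ n) Z → x̃ x Z ≤ largestSum ∣ Z ∣ x
x̃-≤-largestSum x [] = ℤ.≤-refl
x̃-≤-largestSum x (inside ∷ Z) = begin
  x̃ x (inside ∷ Z)                                        ≡⟨ x̃-∷ x inside Z ⟩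
  x zero + x̃ (x ∘ suc) Z                                  ≤⟨ ℤ.+-monoʳ-≤ (x zero) (x̃-≤-largestSum (x ∘ suc) Z) ⟩
  x zero + largestSum ∣ Z ∣ (x ∘ suc)                     ≤⟨ prefixSum-insert↓-head (x zero) ∣ Z ∣ ((x ∘ suc) ↓) ⟩
  prefixSum (ℕ.suc ∣ Z ∣) (insert↓ (x zero) ((x ∘ suc) ↓)) ≡⟨ cong (prefixSum (ℕ.suc ∣ Z ∣)) (↓-suc x) ⟨
  largestSum (ℕ.suc ∣ Z ∣) x                              ∎
  where open ℤ.≤-Reasoning
x̃-≤-largestSum {ℕ.suc n} x (outside ∷ Z) = begin
  x̃ x (outside ∷ Z)                                ≡⟨ trans (x̃-∷ x outside Z) (ℤ.+-identityˡ _) ⟩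
  x̃ (x ∘ suc) Z                                    ≤⟨ x̃-≤-largestSum (x ∘ suc) Z ⟩
  largestSum (∣ Z ∣) (x ∘ suc)                     ≤⟨ prefixSum-insert↓ (x zero) (↓-sorted (x ∘ suc)) ∣Z∣≤∣x↓∣ ⟩
  prefixSum (∣ Z ∣) (insert↓ (x zero) ((x ∘ suc) ↓)) ≡⟨ cong (prefixSum (∣ Z ∣)) (↓-suc x) ⟨
  largestSum (∣ Z ∣) x                             ∎
  where
  open ℤ.≤-Reasoning
  ∣Z∣≤∣x↓∣ : ∣ Z ∣ ℕ.≤ length ((x ∘ suc) ↓)
  ∣Z∣≤∣x↓∣ = subst (λ m → ∣ Z ∣ ℕ.≤ m) (sym (length-↓ (x ∘ suc))) (∣p∣≤n Z)

largestSum-attained : ∀ {n} (x : Vecℤ n) {k} → k ℕ.≤ n → Σ (Subset n) λ Z → ∣ Z ∣ ≡ k × x̃ x Z ≡ largestSum k x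
largestSum-attained {ℕ.zero}  x {ℕ.zero} _ = [] , refl , refl
largestSum-attained {ℕ.suc n} x {ℕ.zero} _ = ⊥ , ∣⊥∣≡0 (ℕ.suc n) , x̃-⊥ x
largestSum-attained {ℕ.suc n} x {ℕ.suc k} (s≤s k≤n)
  with prefixSum-insert↓-cases (x zero) k ((x ∘ suc) ↓)
... | inj₁ enters with largestSum-attained (x ∘ suc) k≤n
...   | Z , ∣Z∣≡k , attained = inside ∷ Z , cong ℕ.suc ∣Z∣≡k , (begin
  x̃ x (inside ∷ Z)                                   ≡⟨ x̃-∷ x inside Z ⟩
  x zero + x̃ (x ∘ suc) Z                             ≡⟨ cong (_+_ (x zero)) attained ⟩
  x zero + largestSum k (x ∘ suc)                    ≡⟨ enters ⟨
  prefixSum (ℕ.suc k) (insert↓ (x zero) ((x ∘ suc) ↓)) ≡⟨ cong (prefixSum (ℕ.suc k)) (↓-suc x) ⟨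
  largestSum (ℕ.suc k) x                             ∎)
  where open ≡-Reasoning
largestSum-attained {ℕ.suc n} x {ℕ.suc k} (s≤s k≤n) | inj₂ (unchanged , k<∣x↓∣)
  with largestSum-attained (x ∘ suc) (subst (ℕ.suc k ℕ.≤_) (length-↓ (x ∘ suc)) k<∣x↓∣)
... | Z , ∣Z∣≡k , attained = outside ∷ Z , ∣Z∣≡k , (begin
  x̃ x (outside ∷ Z)                                  ≡⟨ trans (x̃-∷ x outside Z) (ℤ.+-identityˡ _) ⟩
  x̃ (x ∘ suc) Z                                      ≡⟨ attained ⟩
  largestSum (ℕ.suc k) (x ∘ suc)                     ≡⟨ unchanged ⟨
  prefixSum (ℕ.suc k) (insert↓ (x zero) ((x ∘ suc) ↓)) ≡⟨ cong (prefixSum (ℕ.suc k)) (↓-suc x) ⟨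
  largestSum (ℕ.suc k) x                             ∎)
  where open ≡-Reasoning

largestSum-transfer : ∀ {n} (x : Vecℤ n) {a b k} → x b < x a → k ℕ.≤ n →
                      largestSum k (transfer x a b) ≤ largestSum k x
largestSum-transfer x {a} {b} xb<xa k≤n with largestSum-attained (transfer x a b) k≤n
... | Z , refl , attained = begin
  largestSum (∣ Z ∣) (transfer x a b) ≡⟨ attained ⟨
  x̃ (transfer x a b) Z                ≤⟨ bound (x̃-transfer x (≢-from-< x xb<xa ∘ sym) Z) ⟩
  largestSum (∣ Z ∣) x                ∎
  where
  open ℤ.≤-Reasoning
  gain : x̃ (transfer x a b) Z + 0ℤ ≡ x̃ x Z + 1ℤ → lookup Z a ≡ outside → lookup Z b ≡ inside →
         x̃ (transfer x a b) Z + x b ≤ x̃ x (replace Z b a) + x b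
  gain moved a∉Z b∈Z = begin
    x̃ (transfer x a b) Z + x b ≡⟨ cong (_+ x b) (trans (sym (ℤ.+-identityʳ (x̃ (transfer x a b) Z))) moved) ⟩
    (x̃ x Z + 1ℤ) + x b         ≡⟨ ℤ.+-assoc (x̃ x Z) 1ℤ (x b) ⟩
    x̃ x Z + (1ℤ + x b)         ≤⟨ ℤ.+-monoʳ-≤ (x̃ x Z) (ℤ.i<j⇒suc[i]≤j xb<xa) ⟩
    x̃ x Z + x a                ≡⟨ x̃-replace x {Z} a∉Z b∈Z ⟨
    x̃ x (replace Z b a) + x b  ∎
  bound : x̃ (transfer x a b) Z + weight (lookup Z a) 1ℤ ≡ x̃ x Z + weight (lookup Z b) 1ℤ →
          x̃ (transfer x a b) Z ≤ largestSum ∣ Z ∣ x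
  bound moved with lookup Z a in Za | lookup Z b in Zb
  ... | inside  | inside  = ℤ.≤-trans (≤-from-+-≡ moved ℤ.≤-refl) (x̃-≤-largestSum x Z)
  ... | inside  | outside = ℤ.≤-trans (≤-from-+-≡ moved (ℤ.+≤+ z≤n)) (x̃-≤-largestSum x Z)
  ... | outside | outside = ℤ.≤-trans (≤-from-+-≡ moved ℤ.≤-refl) (x̃-≤-largestSum x Z)
  ... | outside | inside  = begin
    x̃ (transfer x a b) Z             ≤⟨ +-cancelʳ-≤ (x b) (gain moved Za Zb) ⟩
    x̃ x (replace Z b a)              ≤⟨ x̃-≤-largestSum x (replace Z b a) ⟩
    largestSum (∣ replace Z b a ∣) x ≡⟨ cong (λ k → largestSum k x) (∣replace∣ {Z = Z} Za Zb) ⟩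
    largestSum (∣ Z ∣) x             ∎

≤dec-from-largestSum : ∀ {n} {x y : Vecℤ n} →
  (∀ k → 1 ℕ.≤ k → k ℕ.≤ n → largestSum k x ≤ largestSum k y) → x ≤dec y
≤dec-from-largestSum {x = x} {y} x≤y = LexLeq-from-prefixSum (x ↓) (y ↓) (trans (length-↓ x) (sym (length-↓ y)))
  (λ k 1≤k k≤∣x↓∣ → x≤y k 1≤k (subst (k ℕ.≤_) (length-↓ x) k≤∣x↓∣))

≤dec-largestSum-≥⇒↓≡ : ∀ {n} {x y : Vecℤ n} → x ≤dec y →
  (∀ k → k ℕ.≤ n → largestSum k y ≤ largestSum k x) → x ↓ ≡ y ↓
≤dec-largestSum-≥⇒↓≡ {x = x} {y} x≤y y≤x = LexLeq-prefixSum-≥⇒≡ (x ↓) (y ↓) x≤y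
  (λ k _ k≤∣x↓∣ → y≤x k (subst (k ℕ.≤_) (length-↓ x) k≤∣x↓∣))

-- Base polyhedra

module BasePolyhedron {n} (P : SupermodularFn n) where
  open SupermodularFn P

  Tight : Vecℤ n → Subset n → Set
  Tight x Z = p Z ≡ just (x̃ x Z)

  InB? : ∀ x → Dec (InB P x)
  InB? x = (x̃ x ⊤ ℤ.≟ pS) ×-dec allSubsets? (λ Z → x̃ x Z ≥∞? p Z)

  InB-≤-x̃ : ∀ {x Z c} → InB P x → p Z ≡ just c → c ≤ x̃ x Z
  InB-≤-x̃ {x} {Z} (_ , x̃≥p) pZ≡c = subst (x̃ x Z ≥∞_) pZ≡c (x̃≥p Z)

  InB-antichain : ∀ {x y} → InB P x → InB P y → (∀ i → x i ≤ y i) → ∀ i → x i ≡ y i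
  InB-antichain {x} {y} (x̃x⊤≡pS , _) (x̃y⊤≡pS , _) x≤y i =
    ℤ.≤-antisym (x≤y i) (ℤ.≮⇒≥ λ xi<yi → ℤ.<-irrefl sums-equal (sum-mono-< x≤y i xi<yi))
    where
    sums-equal : sum x ≡ sum y
    sums-equal = trans (sym (x̃-⊤ x)) (trans x̃x⊤≡pS (trans (sym x̃y⊤≡pS) (x̃-⊤ y)))

  tight-⊤ : ∀ {x} → InB P x → Tight x ⊤
  tight-⊤ (x̃⊤≡pS , _) = trans p-full (cong just (sym x̃⊤≡pS))

  tight-⊥ : ∀ {x} → Tight x ⊥
  tight-⊥ {x} = trans p-empty (cong just (sym (x̃-⊥ x)))

  tight-∩-∪ : ∀ {x X Y} → InB P x → Tight x X → Tight x Y → Tight x (X ∩ Y) × Tight x (X ∪ Y)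
  tight-∩-∪ {x} {X} {Y} xB tX tY with supermod X Y _ _ tX tY
  ... | c , d , pc , pd , super
    with ≤-+-squeeze (InB-≤-x̃ xB pc) (InB-≤-x̃ xB pd) (subst (_≤ c + d) (sym (x̃-modular x X Y)) super)
  ... | c≡ , d≡ = trans pc (cong just c≡) , trans pd (cong just d≡)

  tight-⋂ : ∀ {k x} → InB P x → (F : Fin k → Subset n) → (∀ j → Tight x (F j)) → Tight x (⋂ (tabulate F))
  tight-⋂ {ℕ.zero}  xB F _      = tight-⊤ xB
  tight-⋂ {ℕ.suc k} xB F tight = proj₁ (tight-∩-∪ xB (tight zero) (tight-⋂ xB (F ∘ suc) (tight ∘ suc)))

  tight-⋃ : ∀ {k x} → InB P x → (F : Fin k → Subset n) → (∀ j → Tight x (F j)) → Tight x (⋃ (tabulate F))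
  tight-⋃ {ℕ.zero}  xB F _      = tight-⊥
  tight-⋃ {ℕ.suc k} xB F tight = proj₂ (tight-∩-∪ xB (tight zero) (tight-⋃ xB (F ∘ suc) (tight ∘ suc)))

  -- y(T ∖ C) ≤ m(T ∖ C): supermodularity of p at T and C, y being tight on T and m on C.
  tight-∖-≤ : ∀ {y m T C} → InB P y → InB P m → Tight y T → Tight m C →
              x̃ y T + x̃ m (T ∩ C) ≤ x̃ y (T ∩ C) + x̃ m T
  tight-∖-≤ {y} {m} {T} {C} yB mB tT tC with supermod T C _ _ tT tC
  ... | c , d , pc , pd , super = +-cancelʳ-≤ mC (begin
    (yT + m∩) + mC   ≡⟨ xy∙z≈xz∙y yT m∩ mC ⟩
    (yT + mC) + m∩   ≤⟨ ℤ.+-monoˡ-≤ m∩ (ℤ.≤-trans super (ℤ.+-mono-≤ (InB-≤-x̃ yB pc) (InB-≤-x̃ mB pd))) ⟩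
    (y∩ + m∪) + m∩   ≡⟨ xy∙z≈x∙zy y∩ m∪ m∩ ⟩
    y∩ + (m∩ + m∪)   ≡⟨ cong (_+_ y∩) (x̃-modular m T C) ⟩
    y∩ + (mT + mC)   ≡⟨ ℤ.+-assoc y∩ mT mC ⟨
    (y∩ + mT) + mC   ∎)
    where
    open ℤ.≤-Reasoning
    yT y∩ mT mC m∩ m∪ : ℤ
    yT = x̃ y T
    y∩ = x̃ y (T ∩ C)
    mT = x̃ m T
    mC = x̃ m C
    m∩ = x̃ m (T ∩ C)
    m∪ = x̃ m (T ∪ C)

  exchange : ∀ {x a b} → InB P x → a ≢ b → ¬ InB P (transfer x a b) →
             Σ (Subset n) λ Z → Tight x Z × lookup Z a ≡ inside × lookup Z b ≡ outside
  exchange {x} {a} {b} xB a≢b x′∉B with anySubset? (λ Z → ¬? (x̃ (transfer x a b) Z ≥∞? p Z))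
  ... | no noViolation = ⊥-elim (x′∉B (trans (x̃-transfer-⊤ x a≢b) (proj₁ xB) ,
          λ Z → decidable-stable (x̃ (transfer x a b) Z ≥∞? p Z) (λ violated → noViolation (Z , violated))))
  ... | yes (Z , violated) with p Z in pZ
  ...   | nothing = ⊥-elim (violated _)
  ...   | just c  = Z , separates (x̃-transfer x a≢b Z)
    where
    not-below : {A : Set} → x̃ x Z ≤ x̃ (transfer x a b) Z → A
    not-below x̃≤x̃′ = ⊥-elim (violated (ℤ.≤-trans (InB-≤-x̃ xB pZ) x̃≤x̃′))
    separates : x̃ (transfer x a b) Z + weight (lookup Z a) 1ℤ ≡ x̃ x Z + weight (lookup Z b) 1ℤ →
                Tight x Z × lookup Z a ≡ inside × lookup Z b ≡ outside
    separates moved with lookup Z a | lookup Z b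
    ... | inside  | inside  = not-below (≤-from-+-≡ (sym moved) ℤ.≤-refl)
    ... | outside | outside = not-below (≤-from-+-≡ (sym moved) ℤ.≤-refl)
    ... | outside | inside  = not-below (≤-from-+-≡ (sym moved) (ℤ.+≤+ z≤n))
    ... | inside  | outside = trans pZ (cong just c≡x̃) , refl , refl
      where
      c≡x̃ : c ≡ x̃ x Z
      c≡x̃ = ℤ.≤-antisym (InB-≤-x̃ xB pZ) (begin
        x̃ x Z                          ≡⟨ ℤ.+-identityʳ (x̃ x Z) ⟨
        x̃ x Z + 0ℤ                     ≡⟨ trans (sym moved) (ℤ.+-comm (x̃ (transfer x a b) Z) 1ℤ) ⟩
        1ℤ + x̃ (transfer x a b) Z      ≤⟨ ℤ.i<j⇒suc[i]≤j (ℤ.≰⇒> violated) ⟩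
        c                              ∎)
        where open ℤ.≤-Reasoning

  module _ {m} (m-decMin : DecMin P m) where

    private
      mB : InB P m
      mB = proj₁ m-decMin

    -- Such a transfer preserves every largest sum, hence m↓, yet lowers the sum of squares.
    decMin-no-steep-transfer : ∀ {s t} → m s + 1ℤ < m t → ¬ InB P (transfer m t s)
    decMin-no-steep-transfer {s} {t} steep m′B = ℤ.<-irrefl squares-equal (squares-transfer-< {m s} {m t} steep)
      where
      m′ : Vecℤ n
      m′ = transfer m t s
      ms<mt : m s < m t
      ms<mt = +1<⇒< steep
      square : ℤ → ℤ
      square v = v * v
      ↓-equal : m ↓ ≡ m′ ↓
      ↓-equal = ≤dec-largestSum-≥⇒↓≡ (proj₂ m-decMin m′ m′B) (λ k k≤n → largestSum-transfer m ms<mt k≤n)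
      sums-of-squares : sum (square ∘ m) ≡ sum (square ∘ m′)
      sums-of-squares = trans (sym (sumℤ-map-↓ square m))
                          (trans (cong (sumℤ ∘ map square) ↓-equal) (sumℤ-map-↓ square m′))
      squares-equal : square (m t - 1ℤ) + square (m s + 1ℤ) ≡ square (m t) + square (m s)
      squares-equal = sym (+-cancelˡ-≡ (sum (square ∘ m)) before after (begin
        sum (square ∘ m) + before  ≡⟨ cong (_+ before) sums-of-squares ⟩
        sum (square ∘ m′) + before ≡⟨ sum-transfer m (≢-from-< m ms<mt ∘ sym) (λ _ → square) ⟩
        sum (square ∘ m) + after   ∎))
        where
        open ≡-Reasoning
        before after : ℤ
        before = square (m t) + square (m s)
        after  = square (m t - 1ℤ) + square (m s + 1ℤ)

    decMin-separating : ∀ {s t} → m s + 1ℤ < m t →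
                        Σ (Subset n) λ Z → Tight m Z × lookup Z t ≡ inside × lookup Z s ≡ outside
    decMin-separating steep = exchange mB (≢-from-< m (+1<⇒< steep) ∘ sym) (decMin-no-steep-transfer steep)

    -- Assuming no improving transfer out of s, the tight sets of y around s and of m avoiding s
    -- combine into T and C with y(T ∖ C) > m(T ∖ C), contradicting supermodularity.
    module NoImprovingTransfer {y s} (yB : InB P y) (ms<ys : m s < y s)
             (stuck : ∀ t → y t < m t → y t < y s → ¬ InB P (transfer y s t)) where

      y-tight-around-s : ∀ t → Σ (Subset n) λ Z → Tight y Z × lookup Z s ≡ inside ×
                                                    (y t < m t → y t < y s → lookup Z t ≡ outside)
      y-tight-around-s t with y t ℤ.<? m t | y t ℤ.<? y s
      ... | yes yt<mt | yes yt<ys with exchange yB (≢-from-< y yt<ys ∘ sym) (stuck t yt<mt yt<ys)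
      ...   | Z , tight , s∈Z , t∉Z = Z , tight , s∈Z , λ _ _ → t∉Z
      y-tight-around-s t | no yt≮mt | _ =
        ⊤ , tight-⊤ yB , lookup-replicate s inside , λ yt<mt _ → ⊥-elim (yt≮mt yt<mt)
      y-tight-around-s t | yes _ | no yt≮ys =
        ⊤ , tight-⊤ yB , lookup-replicate s inside , λ _ yt<ys → ⊥-elim (yt≮ys yt<ys)

      m-tight-avoiding-s : ∀ i → Σ (Subset n) λ Z → Tight m Z × lookup Z s ≡ outside ×
                                                      (y s < m i → lookup Z i ≡ inside)
      m-tight-avoiding-s i with y s ℤ.<? m i
      ... | yes ys<mi with decMin-separating (ℤ.≤-<-trans (<⇒+1≤ ms<ys) ys<mi)
      ...   | Z , tight , i∈Z , s∉Z = Z , tight , s∉Z , λ _ → i∈Z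
      m-tight-avoiding-s i | no ys≮mi = ⊥ , tight-⊥ , lookup-replicate s outside , λ ys<mi → ⊥-elim (ys≮mi ys<mi)

      T C : Subset n
      T = ⋂ (tabulate (proj₁ ∘ y-tight-around-s))
      C = ⋃ (tabulate (proj₁ ∘ m-tight-avoiding-s))

      T-tight : Tight y T
      T-tight = tight-⋂ yB _ (proj₁ ∘ proj₂ ∘ y-tight-around-s)

      C-tight : Tight m C
      C-tight = tight-⋃ mB _ (proj₁ ∘ proj₂ ∘ m-tight-avoiding-s)

      s∈T : lookup T s ≡ inside
      s∈T = lookup-⋂-inside _ s (proj₁ ∘ proj₂ ∘ proj₂ ∘ y-tight-around-s)

      s∉C : lookup C s ≡ outside
      s∉C = lookup-⋃-outside _ s (proj₁ ∘ proj₂ ∘ proj₂ ∘ m-tight-avoiding-s)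

      ∉T : ∀ {t} → y t < m t → y t < y s → lookup T t ≡ outside
      ∉T {t} yt<mt yt<ys = lookup-⋂-outside _ t t (proj₂ (proj₂ (proj₂ (y-tight-around-s t))) yt<mt yt<ys)

      ∈C : ∀ {i} → y s < m i → lookup C i ≡ inside
      ∈C {i} ys<mi = lookup-⋃-inside _ i i (proj₂ (proj₂ (proj₂ (m-tight-avoiding-s i))) ys<mi)

      m≤y-on-T∖C : ∀ i → lookup T i ≡ inside → lookup C i ≡ outside → m i ≤ y i
      m≤y-on-T∖C i i∈T i∉C = ℤ.≮⇒≥ λ yi<mi →
        inside≢outside (trans (sym i∈T) (∉T yi<mi (ℤ.<-≤-trans yi<mi mi≤ys)))
        where
        mi≤ys : m i ≤ y s
        mi≤ys = ℤ.≮⇒≥ λ ys<mi → inside≢outside (trans (sym (∈C ys<mi)) i∉C)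

      absurd : Empty
      absurd = ℤ.<⇒≱ (x̃-∖-< {T = T} {C} m≤y-on-T∖C s∈T s∉C ms<ys) (tight-∖-≤ yB mB T-tight C-tight)

    improving-transfer : ∀ {y s} → InB P y → m s < y s →
                         Σ (Fin n) λ t → y t < m t × y t < y s × InB P (transfer y s t)
    improving-transfer {y} {s} yB ms<ys
      with any? (λ t → ((y t ℤ.<? m t) ×-dec (y t ℤ.<? y s)) ×-dec InB? (transfer y s t))
    ... | yes (t , (yt<mt , yt<ys) , y′B) = t , yt<mt , yt<ys , y′B
    ... | no none = ⊥-elim (NoImprovingTransfer.absurd yB ms<ys
                      (λ t yt<mt yt<ys y′B → none (t , (yt<mt , yt<ys) , y′B)))

    decMin-largestSum-≤ : ∀ {k} → k ℕ.≤ n → ∀ {y} → InB P y → largestSum k m ≤ largestSum k y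
    decMin-largestSum-≤ {k} k≤n yB = go (<-wellFounded _) yB
      where
      go : ∀ {y} → Acc ℕ._<_ (distance m y) → InB P y → largestSum k m ≤ largestSum k y
      go {y} (acc closer) yB with any? (λ s → m s ℤ.<? y s)
      ... | no ∄ms<ys = ℤ.≤-reflexive (cong (prefixSum k) (↓-cong λ i →
              sym (InB-antichain yB mB (λ j → ℤ.≮⇒≥ λ mj<yj → ∄ms<ys (j , mj<yj)) i)))
      ... | yes (s , ms<ys) with improving-transfer yB ms<ys
      ...   | t , yt<mt , yt<ys , y′B =
        ℤ.≤-trans (go (closer (distance-transfer {x = m} {y} {s} {t} ms<ys yt<mt)) y′B) (largestSum-transfer y yt<ys k≤n)

theorem3p8 : (n' : ℕ) → (P : SupermodularFn (ℕ.suc n')) → (m : Vecℤ (ℕ.suc n')) →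
             DecMin P m ⇔ SimulMin P m
theorem3p8 n' P m = mk⇔
  (λ m-decMin → proj₁ m-decMin , λ k _ k≤n y yB → decMin-largestSum-≤ m-decMin k≤n yB)
  (λ (mB , minimal) → mB , λ y yB → ≤dec-from-largestSum λ k 1≤k k≤n → minimal k 1≤k k≤n y yB)
  where open BasePolyhedron P
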